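{- Let $G$ be a connected graph. If $F$ is a minimum-size triangle-transversal of $G$, then $G\setminus F$ is connected.
   Context: All graphs are finite and simple. A triangle-transversal of $G$ is a set $F$ of edges such that the graph $G\setminus F$ (obtained by deleting the edges of $F$) contains no triangle. -}

module Defs where

open import Data.Nat using (ℕ; zero; suc; _+_; _≤_)
open import Data.Fin using (Fin; toℕ)
open import Data.Bool using (Bool; true; false; _∧_; not; if_then_else_)
open import Data.List using (List; map)
open import Data.Nat.ListAction using (sum)
open import Data.List using () renaming (allFin to allFinL)
open import Data.Nat using (_<ᵇ_)
open import Data.Empty using (⊥)
open import Relation.Binary.PropositionalEquality using (_≡_)

record Graph (n : ℕ) : Set where
  field
    adj   : Fin n → Fin n → Bool
    sym   : ∀ u v → adj u v ≡ adj v u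
    irrefl : ∀ v → adj v v ≡ false
open Graph public

record EdgeSet (n : ℕ) : Set where
  field
    mem    : Fin n → Fin n → Bool
    memSym : ∀ u v → mem u v ≡ mem v u
open EdgeSet public

_⊆E_ : ∀ {n} → EdgeSet n → Graph n → Set
F ⊆E G = ∀ u v → mem F u v ≡ true → adj G u v ≡ true

size : ∀ {n} → EdgeSet n → ℕ
size {n} F = sum (map (λ u → sum (map (λ v →
  if (toℕ u <ᵇ toℕ v) ∧ mem F u v then 1 else 0) (allFinL n))) (allFinL n))

_∖_ : ∀ {n} → Graph n → EdgeSet n → Graph n
adj (G ∖ F) u v = adj G u v ∧ not (mem F u v)
sym (G ∖ F) u v rewrite sym G u v | memSym F u v = Relation.Binary.PropositionalEquality.refl
  where import Relation.Binary.PropositionalEquality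
irrefl (G ∖ F) v rewrite irrefl G v = Relation.Binary.PropositionalEquality.refl
  where import Relation.Binary.PropositionalEquality

-- G has no triangle (adjacent pairs are automatically distinct by irreflexivity).
TriangleFree : ∀ {n} → Graph n → Set
TriangleFree G = ∀ x y z → adj G x y ≡ true → adj G y z ≡ true → adj G x z ≡ true → ⊥

IsTriangleTransversal : ∀ {n} → Graph n → EdgeSet n → Set
IsTriangleTransversal G F = F ⊆E G × TriangleFree (G ∖ F)
  where open import Data.Product using (_×_)

IsMinTriangleTransversal : ∀ {n} → Graph n → EdgeSet n → Set
IsMinTriangleTransversal G F =
  IsTriangleTransversal G F × (∀ F′ → IsTriangleTransversal G F′ → size F ≤ size F′)
  where open import Data.Product using (_×_)

data Walk {n} (G : Graph n) : Fin n → Fin n → Set where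
  here : ∀ {u} → Walk G u u
  step : ∀ {u w v} → adj G u w ≡ true → Walk G w v → Walk G u v

Connected : ∀ {n} → Graph n → Set
Connected G = ∀ u v → Walk G u v

{-# OPTIONS --safe #-}
-- Suppose an edge ab of a minimum triangle-transversal F had no common neighbour in G ∖ F.
-- Then F − ab would still be a triangle-transversal: a triangle of G ∖ (F − ab) that is not
-- one of G ∖ F uses ab, and its apex is a common neighbour of a and b in G ∖ F.  As F − ab
-- is smaller than F, this is impossible, so every edge of F is bypassed by a path of length
-- two in G ∖ F, and every walk of G can be rerouted through G ∖ F.
module Submission where

open import Defs
open import Data.Nat using (ℕ; _≤_; _<_; _<ᵇ_; s≤s; z≤n)
open import Data.Nat.Properties using (≤-refl; +-mono-≤; +-mono-<-≤; +-mono-≤-<; <⇒<ᵇ; <⇒≱)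
open import Data.Fin using (Fin; toℕ; _≟_)
open import Data.Fin.Properties using (any?; <-cmp)
open import Data.Bool using (true; false; _∧_; if_then_else_)
open import Data.Bool.Properties using () renaming (_≟_ to _≟ᵇ_)
open import Data.List using (List; []; _∷_; map; allFin)
open import Data.Nat.ListAction using (sum)
open import Data.List.Membership.Propositional using (_∈_)
open import Data.List.Membership.Propositional.Properties using (∈-allFin)
open import Data.List.Relation.Unary.Any using (here; there)
open import Data.Product using (_×_; _,_; ∃)
open import Data.Sum using (_⊎_; inj₁; inj₂)
open import Data.Empty using (⊥-elim)
open import Relation.Nullary using (Dec; yes; no; ¬_)
open import Relation.Nullary.Decidable using (_×-dec_; _⊎-dec_)
open import Relation.Binary using (tri<; tri≈; tri>)
open import Relation.Binary.PropositionalEquality using (_≡_; _≢_; refl; trans) renaming (sym to ≡-sym)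

private
  variable
    n : ℕ
    A : Set

sum-map-mono-≤ : {f g : A → ℕ} (xs : List A) → (∀ x → f x ≤ g x) → sum (map f xs) ≤ sum (map g xs)
sum-map-mono-≤ []       f≤g = z≤n
sum-map-mono-≤ (x ∷ xs) f≤g = +-mono-≤ (f≤g x) (sum-map-mono-≤ xs f≤g)

sum-map-mono-< : {f g : A → ℕ} {xs : List A} {y : A} →
                 (∀ x → f x ≤ g x) → y ∈ xs → f y < g y → sum (map f xs) < sum (map g xs)
sum-map-mono-< {xs = _ ∷ xs} f≤g (here refl) fy<gy = +-mono-<-≤ fy<gy (sum-map-mono-≤ xs f≤g)
sum-map-mono-< {xs = x ∷ _}  f≤g (there y∈xs) fy<gy = +-mono-≤-< (f≤g x) (sum-map-mono-< f≤g y∈xs fy<gy)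

adj-sym : (G : Graph n) {x y : Fin n} → adj G x y ≡ true → adj G y x ≡ true
adj-sym G {x} {y} xy = trans (≡-sym (sym G x y)) xy

adj⇒≢ : (G : Graph n) {x y : Fin n} → adj G x y ≡ true → x ≢ y
adj⇒≢ G {x} xy refl with trans (≡-sym xy) (irrefl G x)
... | ()

∖-adj : (G : Graph n) (F : EdgeSet n) {x y : Fin n} →
        adj G x y ≡ true → mem F x y ≡ false → adj (G ∖ F) x y ≡ true
∖-adj G F xy∈G xy∉F rewrite xy∈G | xy∉F = refl

walk-++ : {G : Graph n} {x y z : Fin n} → Walk G x y → Walk G y z → Walk G x z
walk-++ here         q = q
walk-++ (step xw wy) q = step xw (walk-++ wy q)

walk-reroute : {G H : Graph n} → (∀ a b → adj G a b ≡ true → Walk H a b) →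
               ∀ {u v} → Walk G u v → Walk H u v
walk-reroute bypass here                 = here
walk-reroute bypass (step {u} {w} uw wv) = walk-++ (bypass u w uw) (walk-reroute bypass wv)

SameEdge : Fin n → Fin n → Fin n → Fin n → Set
SameEdge a b x y = (x ≡ a × y ≡ b) ⊎ (x ≡ b × y ≡ a)

sameEdge? : (a b x y : Fin n) → Dec (SameEdge a b x y)
sameEdge? a b x y = (x ≟ a ×-dec y ≟ b) ⊎-dec (x ≟ b ×-dec y ≟ a)

SameEdge-swap : {a b x y : Fin n} → SameEdge a b x y → SameEdge a b y x
SameEdge-swap (inj₁ (x≡a , y≡b)) = inj₂ (y≡b , x≡a)
SameEdge-swap (inj₂ (x≡b , y≡a)) = inj₁ (y≡a , x≡b)

SameEdge-functional : {a b x y z : Fin n} → SameEdge a b x y → SameEdge a b x z → y ≡ z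
SameEdge-functional (inj₁ (refl , refl)) (inj₁ (_ , refl))    = refl
SameEdge-functional (inj₁ (refl , refl)) (inj₂ (refl , refl)) = refl
SameEdge-functional (inj₂ (refl , refl)) (inj₁ (refl , refl)) = refl
SameEdge-functional (inj₂ (refl , refl)) (inj₂ (_ , refl))    = refl

deleteEdge : EdgeSet n → Fin n → Fin n → EdgeSet n
mem (deleteEdge F a b) x y with sameEdge? a b x y
... | yes _ = false
... | no  _ = mem F x y
memSym (deleteEdge F a b) x y with sameEdge? a b x y | sameEdge? a b y x
... | yes _   | yes _   = refl
... | yes xy  | no ¬yx  = ⊥-elim (¬yx (SameEdge-swap xy))
... | no ¬xy  | yes yx  = ⊥-elim (¬xy (SameEdge-swap yx))
... | no _    | no _    = memSym F x y

_⊆ₑ_ : EdgeSet n → EdgeSet n → Set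
F′ ⊆ₑ F = ∀ x y → mem F′ x y ≡ true → mem F x y ≡ true

deleteEdge-⊆ : (F : EdgeSet n) (a b : Fin n) → deleteEdge F a b ⊆ₑ F
deleteEdge-⊆ F a b x y xy∈F′ with sameEdge? a b x y
... | no _ = xy∈F′

deleteEdge-∉ : (F : EdgeSet n) (a b : Fin n) → mem (deleteEdge F a b) a b ≡ false
deleteEdge-∉ F a b with sameEdge? a b a b
... | yes _   = refl
... | no ¬ab  = ⊥-elim (¬ab (inj₁ (refl , refl)))

∖-deleteEdge : (G : Graph n) (F : EdgeSet n) {a b x y : Fin n} →
               adj (G ∖ deleteEdge F a b) x y ≡ true → adj (G ∖ F) x y ≡ true ⊎ SameEdge a b x y
∖-deleteEdge G F {a} {b} {x} {y} xy with sameEdge? a b x y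
... | yes xy≐ab = inj₂ xy≐ab
... | no _      = inj₁ xy

edgeCount : EdgeSet n → Fin n → Fin n → ℕ
edgeCount F u v = if (toℕ u <ᵇ toℕ v) ∧ mem F u v then 1 else 0

edgeCount-mono : {F′ F : EdgeSet n} → F′ ⊆ₑ F → ∀ u v → edgeCount F′ u v ≤ edgeCount F u v
edgeCount-mono {F′ = F′} F′⊆F u v with toℕ u <ᵇ toℕ v | mem F′ u v in uv∈F′
... | false | _     = z≤n
... | true  | false = z≤n
... | true  | true  rewrite F′⊆F u v uv∈F′ = ≤-refl

edgeCount-< : {F′ F : EdgeSet n} {p q : Fin n} → toℕ p < toℕ q →
              mem F p q ≡ true → mem F′ p q ≡ false → edgeCount F′ p q < edgeCount F p q
edgeCount-< {p = p} {q} p<q pq∈F pq∉F′ with toℕ p <ᵇ toℕ q | <⇒<ᵇ p<q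
... | true | _ rewrite pq∈F | pq∉F′ = s≤s z≤n

size-< : {F′ F : EdgeSet n} {p q : Fin n} → F′ ⊆ₑ F → toℕ p < toℕ q →
         mem F p q ≡ true → mem F′ p q ≡ false → size F′ < size F
size-< {n} {F′} {F} {p} {q} F′⊆F p<q pq∈F pq∉F′ =
  sum-map-mono-< (λ u → sum-map-mono-≤ (allFin n) (count-mono u)) (∈-allFin p)
    (sum-map-mono-< (count-mono p) (∈-allFin q) (edgeCount-< {F′ = F′} {F} p<q pq∈F pq∉F′))
  where
  count-mono : ∀ u v → edgeCount F′ u v ≤ edgeCount F u v
  count-mono = edgeCount-mono {F′ = F′} {F} F′⊆F

deleteEdge-size-< : (F : EdgeSet n) {a b : Fin n} → a ≢ b → mem F a b ≡ true →
                    size (deleteEdge F a b) < size F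
deleteEdge-size-< F {a} {b} a≢b ab∈F with <-cmp a b
... | tri< a<b _ _ = size-< {F′ = deleteEdge F a b} {F} (deleteEdge-⊆ F a b) a<b
                       ab∈F (deleteEdge-∉ F a b)
... | tri≈ _ a≡b _ = ⊥-elim (a≢b a≡b)
... | tri> _ _ b<a = size-< {F′ = deleteEdge F a b} {F} (deleteEdge-⊆ F a b) b<a
                       (trans (memSym F b a) ab∈F) (trans (memSym (deleteEdge F a b) b a) (deleteEdge-∉ F a b))

CommonNeighbour : Graph n → Fin n → Fin n → Fin n → Set
CommonNeighbour H a b z = adj H a z ≡ true × adj H z b ≡ true

commonNeighbour? : (H : Graph n) (a b z : Fin n) → Dec (CommonNeighbour H a b z)
commonNeighbour? H a b z = (adj H a z ≟ᵇ true) ×-dec (adj H z b ≟ᵇ true)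

module _ (G : Graph n) (F : EdgeSet n) (a b : Fin n) where

  private
    H  = G ∖ F
    H′ = G ∖ deleteEdge F a b

  apex-edge : {x y z : Fin n} → SameEdge a b x y →
              adj H′ x z ≡ true → adj H′ y z ≡ true → adj H x z ≡ true
  apex-edge xy≐ab xz yz with ∖-deleteEdge G F xz
  ... | inj₁ xz∈H  = xz∈H
  ... | inj₂ xz≐ab = ⊥-elim (adj⇒≢ H′ yz (SameEdge-functional xy≐ab xz≐ab))

  apex-commonNeighbour : {x y z : Fin n} → SameEdge a b x y →
                         adj H′ x z ≡ true → adj H′ y z ≡ true → CommonNeighbour H a b z
  apex-commonNeighbour xy≐ab@(inj₁ (refl , refl)) xz yz =
    apex-edge xy≐ab xz yz , adj-sym H (apex-edge (SameEdge-swap xy≐ab) yz xz)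
  apex-commonNeighbour xy≐ab@(inj₂ (refl , refl)) xz yz =
    apex-edge (SameEdge-swap xy≐ab) yz xz , adj-sym H (apex-edge xy≐ab xz yz)

  triangleFree-deleteEdge : TriangleFree H → ¬ ∃ (CommonNeighbour H a b) → TriangleFree H′
  triangleFree-deleteEdge H-free no-apex x y z xy yz xz
    with ∖-deleteEdge G F xy | ∖-deleteEdge G F yz | ∖-deleteEdge G F xz
  ... | inj₂ xy≐ab | _ | _ = no-apex (z , apex-commonNeighbour xy≐ab xz yz)
  ... | _ | inj₂ yz≐ab | _ = no-apex (x , apex-commonNeighbour yz≐ab (adj-sym H′ xy) (adj-sym H′ xz))
  ... | _ | _ | inj₂ xz≐ab = no-apex (y , apex-commonNeighbour xz≐ab xy (adj-sym H′ yz))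
  ... | inj₁ xy∈H | inj₁ yz∈H | inj₁ xz∈H = H-free x y z xy∈H yz∈H xz∈H

  deleteEdge-transversal : IsTriangleTransversal G F → ¬ ∃ (CommonNeighbour H a b) →
                           IsTriangleTransversal G (deleteEdge F a b)
  deleteEdge-transversal (F⊆G , H-free) no-apex =
    (λ x y xy∈F′ → F⊆G x y (deleteEdge-⊆ F a b x y xy∈F′)) , triangleFree-deleteEdge H-free no-apex

minTransversal-commonNeighbour : (G : Graph n) (F : EdgeSet n) → IsMinTriangleTransversal G F →
                                 ∀ {a b} → adj G a b ≡ true → mem F a b ≡ true →
                                 ∃ (CommonNeighbour (G ∖ F) a b)
minTransversal-commonNeighbour G F (F-transversal , F-minimum) {a} {b} ab∈G ab∈F
  with any? (commonNeighbour? (G ∖ F) a b)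
... | yes apex   = apex
... | no no-apex = ⊥-elim (<⇒≱ (deleteEdge-size-< F (adj⇒≢ G ab∈G) ab∈F)
                     (F-minimum (deleteEdge F a b) (deleteEdge-transversal G F a b F-transversal no-apex)))

minTransversal-bypass : (G : Graph n) (F : EdgeSet n) → IsMinTriangleTransversal G F →
                        ∀ a b → adj G a b ≡ true → Walk (G ∖ F) a b
minTransversal-bypass G F F-min a b ab∈G with mem F a b in ab∈F?
... | false = step (∖-adj G F ab∈G ab∈F?) here
... | true with minTransversal-commonNeighbour G F F-min ab∈G ab∈F?
...   | z , az , zb = step az (step zb here)

proposition15 : ∀ {n} (G : Graph n) (F : EdgeSet n) → Connected G → IsMinTriangleTransversal G F → Connected (G ∖ F)
proposition15 G F G-connected F-min u v = walk-reroute (minTransversal-bypass G F F-min) (G-connected u v)
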